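{- Let $\varphi$ be a sequence of pivot operations applicable to a finite simple graph $G$, and let $S=\sup(\varphi)$. Then for vertices $x,y$ with $x\neq y$, $\{x,y\}\in E(G\varphi)$ if and only if $\mathrm{pm}(G|_{S\oplus\{x,y\}})=1$.
   Context: For a graph $H$, $\mathrm{pm}(H)$ is the number of perfect matchings of $H$ modulo $2$ (the empty graph has exactly one perfect matching). $G|_X$ is the induced subgraph on $X$, and $\oplus$ is symmetric difference. For a vertex $x$, $N'(x)=N(x)\cup\{x\}$. Pivot: for an edge $\{u,v\}$, let $V_1=N'(u)\setminus N'(v)$, $V_2=N'(v)\setminus N'(u)$, $V_3=N'(u)\cap N'(v)$; $G[uv]$ is obtained by toggling every pair $\{x,y\}$ with $x\in V_i$, $y\in V_j$, $i\neq j$. A sequence $[v_1v_2]\cdots[v_{n-1}v_n]$ is applicable to $G$ if each $\{v_i,v_{i+1}\}$ is an edge of the graph obtained by applying the preceding pivots; $G\varphi$ is the result. The support $\sup(\varphi)=\{v_1\}\oplus\cdots\oplus\{v_n\}$ is the set of vertices occurring an odd number of times. -}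

module Defs where

open import Data.Nat using (ℕ; zero; suc)
open import Data.Bool using (Bool; true; false; _∧_; _∨_; _xor_; not; if_then_else_)
open import Data.Fin using (Fin; _≟_)
open import Data.Fin.Properties using ()
open import Data.List using (List; []; _∷_; concatMap; map; foldr; allFin)
open import Data.Vec using (Vec; []; _∷_; lookup)
open import Data.Product using (_×_; _,_)
open import Data.Unit using (⊤)
open import Relation.Nullary.Decidable using (⌊_⌋)
open import Relation.Binary.PropositionalEquality using (_≡_)

Adj : ℕ → Set
Adj n = Fin n → Fin n → Bool

record IsSimple {n : ℕ} (G : Adj n) : Set where
  field
    symmetric   : ∀ x y → G x y ≡ G y x
    irreflexive : ∀ x → G x x ≡ false

VSet : ℕ → Set
VSet n = Fin n → Bool

_==_ : ∀ {n} → Fin n → Fin n → Bool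
x == y = ⌊ x ≟ y ⌋

⁅_⁆ : ∀ {n} → Fin n → VSet n
⁅ x ⁆ y = x == y

_⊕_ : ∀ {n} → VSet n → VSet n → VSet n
(A ⊕ B) z = A z xor B z

pair : ∀ {n} → Fin n → Fin n → VSet n
pair x y z = (x == z) ∨ (y == z)

N' : ∀ {n} → Adj n → Fin n → VSet n
N' G x z = G x z ∨ (x == z)

data Class : Set where
  c1 c2 c3 none : Class

classOf : ∀ {n} → Adj n → Fin n → Fin n → Fin n → Class
classOf G u v z with N' G u z | N' G v z
... | true  | false = c1
... | false | true  = c2
... | true  | true  = c3
... | false | false = none

differentV : Class → Class → Bool
differentV c1 c2 = true
differentV c1 c3 = true
differentV c2 c1 = true
differentV c2 c3 = true
differentV c3 c1 = true
differentV c3 c2 = true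
differentV _  _  = false

pivot : ∀ {n} → Adj n → Fin n → Fin n → Adj n
pivot G u v x y = G x y xor differentV (classOf G u v x) (classOf G u v y)

PivotSeq : ℕ → Set
PivotSeq n = List (Fin n × Fin n)

applySeq : ∀ {n} → Adj n → PivotSeq n → Adj n
applySeq G []             = G
applySeq G ((u , v) ∷ φ)  = applySeq (pivot G u v) φ

Applicable : ∀ {n} → Adj n → PivotSeq n → Set
Applicable G []            = ⊤
Applicable G ((u , v) ∷ φ) = (G u v ≡ true) × Applicable (pivot G u v) φ

sup : ∀ {n} → PivotSeq n → VSet n
sup []            z = false
sup ((u , v) ∷ φ) z = ((⁅ u ⁆ ⊕ ⁅ v ⁆) ⊕ sup φ) z

-- A perfect matching M of G|_X is encoded (bijectively) by the map
-- f : Fin n → Fin n sending each x ∈ X to its partner in M and fixing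
-- every vertex outside X.

allVecs : ∀ {n} (k : ℕ) → List (Vec (Fin n) k)
allVecs zero    = [] ∷ []
allVecs {n} (suc k) = concatMap (λ a → map (a ∷_) (allVecs k)) (allFin n)

isPM : ∀ {n} → Adj n → VSet n → Vec (Fin n) n → Bool
isPM {n} G X f = foldr _∧_ true (map ok (allFin n))
  where
    f' : Fin n → Fin n
    f' = lookup f
    ok : Fin n → Bool
    ok x = if X x
           then X (f' x) ∧ not (f' x == x) ∧ (f' (f' x) == x) ∧ G x (f' x)
           else f' x == x

parityCount : List Bool → Bool
parityCount = foldr _xor_ false

-- pm(G|_X) : the number of perfect matchings of G|_X modulo 2
-- (true = 1, false = 0).  For X = ∅ only the identity qualifies,
-- so the empty graph has exactly one perfect matching.
pm : ∀ {n} → Adj n → VSet n → Bool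
pm {n} G X = parityCount (map (isPM G X) (allVecs n))

-- All counting is modulo 2, i.e. in the Boolean ring (Bool, xor, ∧).
-- The development has four parts.
--  1. pm as a GF(2)-sum.  pm G X is a parity count over all maps
--     Fin n → Fin n; we rewrite it as an iterated sum and prove the
--     expansion at a vertex a ∈ X (the analogue of a Laplace expansion)
--         pm(X) = Σ_{b ∈ X, b ≠ a} G(a,b) · pm(X ∖ {a,b}).
--  2. Consequences of the expansion for simple graphs: pm(∅) = 1,
--     pm({w}) = 0, pm({x,y}) = G(x,y), and two "neighbourhood sums".
--  3. The pivot lemma: for an edge uv,  pm(G[uv]|_X) = pm(G|_{X ⊕ {u,v}})
--     for every X.  The pivot toggles adjacency by the bilinear form
--     N'(u)⊗N'(v) + N'(v)⊗N'(u); the lemma is proved by induction on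
--     X ∖ {u,v}, expanding both sides at a vertex c ∈ X ∖ {u,v}.
--  4. Iterating the pivot lemma along φ gives pm(Gφ|_Z) = pm(G|_{Z ⊕ sup φ});
--     taking Z = {x,y} and pm({x,y}) = adjacency yields the theorem.
module Submission where

open import Defs
open import Data.Nat using (ℕ; zero; suc)
open import Data.Fin using (Fin; zero; suc; _≟_)
open import Data.Fin.Properties using (suc-injective)
open import Data.Bool using (Bool; true; false; _∧_; _∨_; _xor_; not; if_then_else_)
open import Data.Bool.Properties
  using (xor-∧-commutativeRing; xor-same; xor-assoc; xor-comm; xor-identityʳ;
         ∧-zeroʳ; ∧-identityʳ; ∧-assoc; ∧-comm; ∨-identityʳ; ∨-zeroʳ; ∨-comm)
open import Data.Maybe using (Maybe; just; nothing)
open import Data.List using (List; []; _∷_; map; foldr; allFin; concatMap; _++_)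
open import Data.List.Properties using (map-++; map-∘; map-cong; map-tabulate)
open import Data.List.Membership.Propositional using (_∈_)
open import Data.List.Membership.Propositional.Properties using (∈-allFin)
open import Data.List.Relation.Unary.Any using (here; there)
open import Data.Vec using (Vec; []; _∷_; lookup; _[_]≔_; tabulate)
open import Data.Vec.Properties using (lookup∘update; lookup∘update′; lookup∘tabulate)
open import Data.Product using (_×_; _,_; proj₁; proj₂)
open import Data.Sum using (_⊎_; inj₁; inj₂)
open import Data.Empty using (⊥; ⊥-elim)
open import Algebra.Bundles using (CommutativeRing)
open import Relation.Binary.PropositionalEquality
open import Relation.Nullary using (¬_; yes; no; Dec)
open import Function.Bundles using (_⇔_; mk⇔)
open import Tactic.RingSolver using (solve-∀)
open import Tactic.RingSolver.Core.AlmostCommutativeRing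
  using (AlmostCommutativeRing; fromCommutativeRing)

open import Algebra.Properties.Semiring.Sum
  (CommutativeRing.semiring xor-∧-commutativeRing)
  using (sum; sum-cong-≗; sum-replicate-zero; ∑-distrib-+; ∑-comm; *-distribˡ-sum)

boolRing : AlmostCommutativeRing _ _
boolRing = fromCommutativeRing xor-∧-commutativeRing isZero
  where
    isZero : ∀ x → Maybe (false ≡ x)
    isZero false = just refl
    isZero true  = nothing

xor-cancelˡ : ∀ a b → a xor (a xor b) ≡ b
xor-cancelˡ a b = trans (sym (xor-assoc a a b)) (cong (_xor b) (xor-same a))

∧-swap : ∀ x y z → x ∧ (y ∧ z) ≡ y ∧ (x ∧ z)
∧-swap = solve-∀ boolRing

∧-true⁻ : ∀ {a b} → a ∧ b ≡ true → a ≡ true × b ≡ true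
∧-true⁻ {true} e = refl , e

∧-true⁺ : ∀ {a b} → a ≡ true → b ≡ true → a ∧ b ≡ true
∧-true⁺ refl refl = refl

true≢false : ∀ {a} → a ≡ true → a ≡ false → ⊥
true≢false refl ()

bool-cases : (a : Bool) → a ≡ true ⊎ a ≡ false
bool-cases true  = inj₁ refl
bool-cases false = inj₂ refl

not-true⁻ : ∀ {a} → not a ≡ true → a ≡ false
not-true⁻ {false} e = refl

not-true⁺ : ∀ {a} → a ≡ false → not a ≡ true
not-true⁺ refl = refl

bool-ext : ∀ {a b} → (a ≡ true → b ≡ true) → (b ≡ true → a ≡ true) → a ≡ b
bool-ext {false} {false} p q = refl
bool-ext {false} {true}  p q = q refl
bool-ext {true}  {false} p q = sym (p refl)
bool-ext {true}  {true}  p q = refl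

∧-guarded : ∀ {c c' p p'} → c ≡ c' → (c ≡ true → p ≡ p') → c ∧ p ≡ c' ∧ p'
∧-guarded {false} refl h = refl
∧-guarded {true}  refl h = h refl

==-refl : ∀ {n} (x : Fin n) → (x == x) ≡ true
==-refl x with x ≟ x
... | yes _ = refl
... | no x≢x = ⊥-elim (x≢x refl)

==-≢ : ∀ {n} {x y : Fin n} → ¬ x ≡ y → (x == y) ≡ false
==-≢ {x = x} {y} x≢y with x ≟ y
... | yes x≡y = ⊥-elim (x≢y x≡y)
... | no _ = refl

==-≡ : ∀ {n} {x y : Fin n} → (x == y) ≡ true → x ≡ y
==-≡ {x = x} {y} e with x ≟ y
... | yes x≡y = x≡y

==-false⇒≢ : ∀ {n} {x y : Fin n} → (x == y) ≡ false → ¬ x ≡ y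
==-false⇒≢ {x = x} e refl = true≢false (==-refl x) e

==-sym : ∀ {n} (x y : Fin n) → (x == y) ≡ (y == x)
==-sym x y = bool-ext (λ e → trans (cong (y ==_) (==-≡ {x = x} {y} e)) (==-refl y))
                      (λ e → trans (cong (x ==_) (==-≡ {x = y} {x} e)) (==-refl x))

pair≡⊕ : ∀ {n} {u v : Fin n} → ¬ u ≡ v → ∀ z → pair u v z ≡ (⁅ u ⁆ ⊕ ⁅ v ⁆) z
pair≡⊕ {u = u} {v} u≢v z with u ≟ z | v ≟ z
... | yes refl | yes refl = ⊥-elim (u≢v refl)
... | yes _ | no _ = refl
... | no _  | yes _ = refl
... | no _  | no _ = refl

∑ : ∀ {n} → (Fin n → Bool) → Bool
∑ = sum

∑-cong : ∀ {n} {f g : Fin n → Bool} → (∀ i → f i ≡ g i) → ∑ f ≡ ∑ g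
∑-cong = sum-cong-≗

∑-vanishes : ∀ {n} (f : Fin n → Bool) → (∀ i → f i ≡ false) → ∑ f ≡ false
∑-vanishes {n} f f≡0 = trans (∑-cong f≡0) (sum-replicate-zero n)

∑-single : ∀ {n} (f : Fin n → Bool) t → (∀ i → ¬ i ≡ t → f i ≡ false) → ∑ f ≡ f t
∑-single f zero out =
  trans (cong (f zero xor_) (∑-vanishes _ (λ i → out (suc i) (λ ())))) (xor-identityʳ (f zero))
∑-single f (suc t) out =
  trans (cong (_xor ∑ (λ i → f (suc i))) (out zero (λ ())))
        (∑-single (λ i → f (suc i)) t (λ i i≢t → out (suc i) (λ e → i≢t (suc-injective e))))

∑-δ : ∀ {n} (x : Fin n) (h : Fin n → Bool) → ∑ (λ c → (x == c) ∧ h c) ≡ h x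
∑-δ x h = trans (∑-single _ x (λ c c≢x → cong (_∧ h c) (==-≢ (≢-sym c≢x))))
                (cong (_∧ h x) (==-refl x))

-- a double sum of a symmetric function with vanishing diagonal is 0:
-- the off-diagonal terms cancel in pairs
∑∑-symmetric : ∀ {n} (f : Fin n → Fin n → Bool) → (∀ i j → f i j ≡ f j i) →
               (∀ i → f i i ≡ false) → ∑ (λ i → ∑ (f i)) ≡ false
∑∑-symmetric {zero} f sym-f diag = refl
∑∑-symmetric {suc n} f sym-f diag = begin
    (f zero zero xor row0) xor ∑ (λ i → f (suc i) zero xor ∑ (λ j → f (suc i) (suc j)))
  ≡⟨ cong₂ (λ d s → (d xor row0) xor s) (diag zero)
           (∑-distrib-+ (λ i → f (suc i) zero) (λ i → ∑ (λ j → f (suc i) (suc j)))) ⟩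
    row0 xor (∑ (λ i → f (suc i) zero) xor ∑ (λ i → ∑ (λ j → f (suc i) (suc j))))
  ≡⟨ cong₂ (λ c s → row0 xor (c xor s)) (∑-cong (λ i → sym-f (suc i) zero))
           (∑∑-symmetric (λ i j → f (suc i) (suc j)) (λ i j → sym-f (suc i) (suc j)) (λ i → diag (suc i))) ⟩
    row0 xor (row0 xor false)
  ≡⟨ xor-cancelˡ row0 false ⟩
    false
  ∎
  where
    open ≡-Reasoning
    row0 : Bool
    row0 = ∑ (λ j → f zero (suc j))

∑ᵥ : ∀ {n} k → (Vec (Fin n) k → Bool) → Bool
∑ᵥ zero    F = F []
∑ᵥ (suc k) F = ∑ (λ c → ∑ᵥ k (λ w → F (c ∷ w)))

parity-++ : ∀ xs ys → parityCount (xs ++ ys) ≡ parityCount xs xor parityCount ys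
parity-++ []       ys = refl
parity-++ (x ∷ xs) ys = trans (cong (x xor_) (parity-++ xs ys)) (sym (xor-assoc x _ _))

parity-allFin : ∀ {n} (h : Fin n → Bool) → parityCount (map h (allFin n)) ≡ ∑ h
parity-allFin {n} h = trans (cong parityCount (map-tabulate (λ i → i) h)) (parity-tabulate h)
  where
    parity-tabulate : ∀ {m} (g : Fin m → Bool) → parityCount (Data.List.tabulate g) ≡ ∑ g
    parity-tabulate {zero}  g = refl
    parity-tabulate {suc m} g = cong (g zero xor_) (parity-tabulate (λ i → g (suc i)))

parity-concatMap : ∀ {A B : Set} (F : B → Bool) (g : A → List B) (as : List A) →
  parityCount (map F (concatMap g as)) ≡ parityCount (map (λ a → parityCount (map F (g a))) as)
parity-concatMap F g []       = refl
parity-concatMap F g (a ∷ as) =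
  trans (cong parityCount (map-++ F (g a) (concatMap g as)))
        (trans (parity-++ (map F (g a)) (map F (concatMap g as)))
               (cong (parityCount (map F (g a)) xor_) (parity-concatMap F g as)))

parity-allVecs : ∀ {n} k (F : Vec (Fin n) k → Bool) → parityCount (map F (allVecs k)) ≡ ∑ᵥ k F
parity-allVecs zero    F = xor-identityʳ (F [])
parity-allVecs {n} (suc k) F =
  trans (parity-concatMap F (λ c → map (c ∷_) (allVecs k)) (allFin n))
        (trans (cong parityCount (map-cong inner (allFin n)))
               (parity-allFin (λ c → ∑ᵥ k (λ w → F (c ∷ w)))))
  where
    inner : ∀ c → parityCount (map F (map (c ∷_) (allVecs k))) ≡ ∑ᵥ k (λ w → F (c ∷ w))
    inner c = trans (cong parityCount (sym (map-∘ (allVecs k)))) (parity-allVecs k (λ w → F (c ∷ w)))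

pm≡∑ᵥ : ∀ {n} (G : Adj n) (X : VSet n) → pm G X ≡ ∑ᵥ n (isPM G X)
pm≡∑ᵥ {n} G X = parity-allVecs n (isPM G X)

∑ᵥ-cong : ∀ {n} k {F F' : Vec (Fin n) k → Bool} → (∀ w → F w ≡ F' w) → ∑ᵥ k F ≡ ∑ᵥ k F'
∑ᵥ-cong zero    e = e []
∑ᵥ-cong (suc k) e = ∑-cong (λ c → ∑ᵥ-cong k (λ w → e (c ∷ w)))

∑ᵥ-vanishes : ∀ {n} k (F : Vec (Fin n) k → Bool) → (∀ w → F w ≡ false) → ∑ᵥ k F ≡ false
∑ᵥ-vanishes zero    F e = e []
∑ᵥ-vanishes (suc k) F e = ∑-vanishes _ (λ c → ∑ᵥ-vanishes k (λ w → F (c ∷ w)) (λ w → e (c ∷ w)))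

∑ᵥ-∧ : ∀ {n} k (c : Bool) (F : Vec (Fin n) k → Bool) → ∑ᵥ k (λ w → c ∧ F w) ≡ c ∧ ∑ᵥ k F
∑ᵥ-∧ zero    c F = refl
∑ᵥ-∧ (suc k) c F =
  trans (∑-cong (λ x → ∑ᵥ-∧ k c (λ w → F (x ∷ w))))
        (sym (*-distribˡ-sum c (λ x → ∑ᵥ k (λ w → F (x ∷ w)))))

∑ᵥ-∑ : ∀ {n m} k (g : Fin m → Vec (Fin n) k → Bool) →
       ∑ᵥ k (λ w → ∑ (λ c → g c w)) ≡ ∑ (λ c → ∑ᵥ k (g c))
∑ᵥ-∑ zero    g = refl
∑ᵥ-∑ (suc k) g = trans (∑-cong (λ x → ∑ᵥ-∑ k (λ c w → g c (x ∷ w))))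
                       (∑-comm (λ x c → ∑ᵥ k (λ w → g c (x ∷ w))))

∑ᵥ-unique : ∀ {n} k (F : Vec (Fin n) k → Bool) (t : Vec (Fin n) k) →
            (∀ w → F w ≡ true → ∀ i → lookup w i ≡ lookup t i) → F t ≡ true → ∑ᵥ k F ≡ true
∑ᵥ-unique zero    F []       only Ft = Ft
∑ᵥ-unique (suc k) F (t ∷ ts) only Ft =
  trans (∑-single _ t (λ c c≢t → ∑ᵥ-vanishes k (λ w → F (c ∷ w)) (off c c≢t)))
        (∑ᵥ-unique k (λ w → F (t ∷ w)) ts (λ w Fw i → only (t ∷ w) Fw (suc i)) Ft)
  where
    off : ∀ c → ¬ c ≡ t → ∀ w → F (c ∷ w) ≡ false
    off c c≢t w with bool-cases (F (c ∷ w))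
    ... | inj₁ Fcw = ⊥-elim (c≢t (only (c ∷ w) Fcw zero))
    ... | inj₂ ¬Fcw = ¬Fcw

∑ᵥ-partition : ∀ {n} k (a : Fin k) (F : Vec (Fin n) k → Bool) →
               ∑ᵥ k F ≡ ∑ (λ c → ∑ᵥ k (λ f → (lookup f a == c) ∧ F f))
∑ᵥ-partition k a F = trans (∑ᵥ-cong k (λ f → sym (∑-δ (lookup f a) (λ _ → F f))))
                           (∑ᵥ-∑ k (λ c f → (lookup f a == c) ∧ F f))

-- reassigning the coordinate a from the value c to c' is a bijection
-- between {f | f a = c} and {f | f a = c'}
∑ᵥ-reassign : ∀ {n} k (a : Fin k) (c c' : Fin n) (F : Vec (Fin n) k → Bool) →
  ∑ᵥ k (λ f → (lookup f a == c) ∧ F (f [ a ]≔ c')) ≡ ∑ᵥ k (λ f → (lookup f a == c') ∧ F f)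
∑ᵥ-reassign (suc k) zero c c' F = begin
    ∑ (λ x → ∑ᵥ k (λ w → (x == c) ∧ F (c' ∷ w)))
  ≡⟨ ∑-cong (λ x → ∑ᵥ-∧ k (x == c) (λ w → F (c' ∷ w))) ⟩
    ∑ (λ x → (x == c) ∧ ∑ᵥ k (λ w → F (c' ∷ w)))
  ≡⟨ ∑-δ' c (λ _ → ∑ᵥ k (λ w → F (c' ∷ w))) ⟩
    ∑ᵥ k (λ w → F (c' ∷ w))
  ≡⟨ sym (∑-δ' c' (λ x → ∑ᵥ k (λ w → F (x ∷ w)))) ⟩
    ∑ (λ x → (x == c') ∧ ∑ᵥ k (λ w → F (x ∷ w)))
  ≡⟨ sym (∑-cong (λ x → ∑ᵥ-∧ k (x == c') (λ w → F (x ∷ w)))) ⟩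
    ∑ (λ x → ∑ᵥ k (λ w → (x == c') ∧ F (x ∷ w)))
  ∎
  where
    open ≡-Reasoning
    ∑-δ' : ∀ x (h : Fin _ → Bool) → ∑ (λ y → (y == x) ∧ h y) ≡ h x
    ∑-δ' x h = trans (∑-cong (λ y → cong (_∧ h y) (==-sym y x))) (∑-δ x h)
∑ᵥ-reassign (suc k) (suc a) c c' F = ∑-cong (λ x → ∑ᵥ-reassign k a c c' (λ w → F (x ∷ w)))

matchTest : ∀ {n} → Adj n → VSet n → Vec (Fin n) n → Fin n → Bool
matchTest G X f x =
  if X x then X (lookup f x) ∧ not (lookup f x == x) ∧ (lookup f (lookup f x) == x) ∧ G x (lookup f x)
         else lookup f x == x

and-allFin⁻ : ∀ {n} (h : Fin n → Bool) → foldr _∧_ true (map h (allFin n)) ≡ true → ∀ i → h i ≡ true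
and-allFin⁻ h e = and-tabulate⁻ h (trans (cong (foldr _∧_ true) (sym (map-tabulate (λ i → i) h))) e)
  where
    and-tabulate⁻ : ∀ {m} (g : Fin m → Bool) → foldr _∧_ true (Data.List.tabulate g) ≡ true → ∀ i → g i ≡ true
    and-tabulate⁻ g e zero    = proj₁ (∧-true⁻ e)
    and-tabulate⁻ g e (suc i) = and-tabulate⁻ (λ j → g (suc j)) (proj₂ (∧-true⁻ {g zero} e)) i

and-allFin⁺ : ∀ {n} (h : Fin n → Bool) → (∀ i → h i ≡ true) → foldr _∧_ true (map h (allFin n)) ≡ true
and-allFin⁺ h e = trans (cong (foldr _∧_ true) (map-tabulate (λ i → i) h)) (and-tabulate⁺ h e)
  where
    and-tabulate⁺ : ∀ {m} (g : Fin m → Bool) → (∀ i → g i ≡ true) → foldr _∧_ true (Data.List.tabulate g) ≡ true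
    and-tabulate⁺ {zero}  g e = refl
    and-tabulate⁺ {suc m} g e = ∧-true⁺ (e zero) (and-tabulate⁺ (λ j → g (suc j)) (λ i → e (suc i)))

module _ {n : ℕ} (G : Adj n) (X : VSet n) (f : Fin n → Fin n) where

  record PairedAt (x : Fin n) : Set where
    field
      partner∈   : X (f x) ≡ true
      partner≢   : ¬ f x ≡ x
      involutive : f (f x) ≡ x
      edge       : G x (f x) ≡ true

  record IsMatchingMap : Set where
    field
      fixes : ∀ x → X x ≡ false → f x ≡ x
      pairs : ∀ x → X x ≡ true → PairedAt x

open PairedAt
open IsMatchingMap

module _ {n : ℕ} (G : Adj n) (X : VSet n) (f : Vec (Fin n) n) where

  isPM-sound : isPM G X f ≡ true → IsMatchingMap G X (lookup f)
  isPM-sound e = record { fixes = fixes′ ; pairs = pairs′ }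
    where
      test : ∀ x → matchTest G X f x ≡ true
      test = and-allFin⁻ (matchTest G X f) e
      fixes′ : ∀ x → X x ≡ false → lookup f x ≡ x
      fixes′ x x∉X with test x
      ... | t rewrite x∉X = ==-≡ t
      pairs′ : ∀ x → X x ≡ true → PairedAt G X (lookup f) x
      pairs′ x x∈X with test x
      ... | t rewrite x∈X =
        let (in′ , t₁) = ∧-true⁻ t ; (ne , t₂) = ∧-true⁻ t₁ ; (inv , ed) = ∧-true⁻ t₂ in
        record { partner∈ = in′ ; partner≢ = ==-false⇒≢ (not-true⁻ ne)
               ; involutive = ==-≡ inv ; edge = ed }

  isPM-complete : IsMatchingMap G X (lookup f) → isPM G X f ≡ true
  isPM-complete m = and-allFin⁺ (matchTest G X f) test
    where
      test : ∀ x → matchTest G X f x ≡ true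
      test x with bool-cases (X x)
      ... | inj₂ x∉X rewrite x∉X = trans (cong (_== x) (fixes m x x∉X)) (==-refl x)
      ... | inj₁ x∈X rewrite x∈X =
        let p = pairs m x x∈X in
        ∧-true⁺ (partner∈ p) (∧-true⁺ (not-true⁺ (==-≢ (partner≢ p)))
          (∧-true⁺ (trans (cong (_== x) (involutive p)) (==-refl x)) (edge p)))

remove₂ : ∀ {n} → VSet n → Fin n → Fin n → VSet n
remove₂ X a b z = X z ∧ not (z == a) ∧ not (z == b)

module _ {n : ℕ} (X : VSet n) (a b : Fin n) where

  remove₂-∈⁻ : ∀ z → remove₂ X a b z ≡ true → X z ≡ true × ¬ z ≡ a × ¬ z ≡ b
  remove₂-∈⁻ z e =
    let (z∈X , r) = ∧-true⁻ e ; (z≢a , z≢b) = ∧-true⁻ r in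
    z∈X , ==-false⇒≢ (not-true⁻ z≢a) , ==-false⇒≢ (not-true⁻ z≢b)

  remove₂-∈⁺ : ∀ z → X z ≡ true → ¬ z ≡ a → ¬ z ≡ b → remove₂ X a b z ≡ true
  remove₂-∈⁺ z z∈X z≢a z≢b = ∧-true⁺ z∈X (∧-true⁺ (not-true⁺ (==-≢ z≢a)) (not-true⁺ (==-≢ z≢b)))

  remove₂-∉ : ∀ z → remove₂ X a b z ≡ false → ¬ z ≡ a → ¬ z ≡ b → X z ≡ false
  remove₂-∉ z e z≢a z≢b with bool-cases (X z)
  ... | inj₂ z∉X = z∉X
  ... | inj₁ z∈X = ⊥-elim (true≢false (remove₂-∈⁺ z z∈X z≢a z≢b) e)

  remove₂-removes : ∀ z → z ≡ a ⊎ z ≡ b → remove₂ X a b z ≡ false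
  remove₂-removes z z∈ab with bool-cases (remove₂ X a b z)
  ... | inj₂ e = e
  ... | inj₁ e with remove₂-∈⁻ z e | z∈ab
  ...   | _ , z≢a , _ | inj₁ z≡a = ⊥-elim (z≢a z≡a)
  ...   | _ , _ , z≢b | inj₂ z≡b = ⊥-elim (z≢b z≡b)

-- A matching map f of G|_X with f a = b (a ∈ X, b ≠ a) is the same as
-- the edge ab together with the matching map g = f[a ↦ a][b ↦ b] of
-- G|_{X ∖ {a,b}}.
module PrescribedPair {n : ℕ} (G : Adj n) (G-sym : ∀ x y → G x y ≡ G y x)
                      (X : VSet n) (a b : Fin n) (a∈X : X a ≡ true) (b≢a : ¬ b ≡ a)
                      (f : Vec (Fin n) n) where
  Y : VSet n
  Y = remove₂ X a b

  g : Vec (Fin n) n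
  g = (f [ a ]≔ a) [ b ]≔ b

  private
    f̂ ĝ : Fin n → Fin n
    f̂ = lookup f
    ĝ = lookup g

    g-b : ĝ b ≡ b
    g-b = lookup∘update b (f [ a ]≔ a) b

    g-a : ĝ a ≡ a
    g-a = trans (lookup∘update′ (≢-sym b≢a) (f [ a ]≔ a) b) (lookup∘update a f a)

    g-other : ∀ x → ¬ x ≡ a → ¬ x ≡ b → ĝ x ≡ f̂ x
    g-other x x≢a x≢b = trans (lookup∘update′ x≢b (f [ a ]≔ a) b) (lookup∘update′ x≢a f a)

  restrict : f̂ a ≡ b → IsMatchingMap G X f̂ →
             f̂ b ≡ a × X b ≡ true × G a b ≡ true × IsMatchingMap G Y ĝ
  restrict fa m = fb , subst (λ z → X z ≡ true) fa (partner∈ pa)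
                , subst (λ z → G a z ≡ true) fa (edge pa) , record { fixes = fixesY ; pairs = pairsY }
    where
      pa : PairedAt G X f̂ a
      pa = pairs m a a∈X
      fb : f̂ b ≡ a
      fb = trans (cong f̂ (sym fa)) (involutive pa)
      fixesY : ∀ x → Y x ≡ false → ĝ x ≡ x
      fixesY x x∉Y = cases (x ≟ a) (x ≟ b)
        where
          cases : Dec (x ≡ a) → Dec (x ≡ b) → ĝ x ≡ x
          cases (yes refl) _        = g-a
          cases (no _)     (yes refl) = g-b
          cases (no x≢a)   (no x≢b) =
            trans (g-other x x≢a x≢b) (fixes m x (remove₂-∉ X a b x x∉Y x≢a x≢b))
      pairsY : ∀ x → Y x ≡ true → PairedAt G Y ĝ x
      pairsY x x∈Y = record
          { partner∈   = subst (λ z → Y z ≡ true) (sym gx) (remove₂-∈⁺ X a b (f̂ x) (partner∈ px) fx≢a fx≢b)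
          ; partner≢   = λ e → partner≢ px (trans (sym gx) e)
          ; involutive = trans (cong ĝ gx) (trans (g-other (f̂ x) fx≢a fx≢b) (involutive px))
          ; edge       = subst (λ z → G x z ≡ true) (sym gx) (edge px) }
        where
          x∈ : X x ≡ true × ¬ x ≡ a × ¬ x ≡ b
          x∈ = remove₂-∈⁻ X a b x x∈Y
          x≢a : ¬ x ≡ a
          x≢a = proj₁ (proj₂ x∈)
          x≢b : ¬ x ≡ b
          x≢b = proj₂ (proj₂ x∈)
          px : PairedAt G X f̂ x
          px = pairs m x (proj₁ x∈)
          gx : ĝ x ≡ f̂ x
          gx = g-other x x≢a x≢b
          fx≢a : ¬ f̂ x ≡ a
          fx≢a e = x≢b (trans (sym (involutive px)) (trans (cong f̂ e) fa))
          fx≢b : ¬ f̂ x ≡ b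
          fx≢b e = x≢a (trans (sym (involutive px)) (trans (cong f̂ e) fb))

  extend : f̂ a ≡ b → f̂ b ≡ a → X b ≡ true → G a b ≡ true → IsMatchingMap G Y ĝ →
           IsMatchingMap G X f̂
  extend fa fb b∈X ab m = record { fixes = fixesX ; pairs = pairsX }
    where
      fixesX : ∀ x → X x ≡ false → f̂ x ≡ x
      fixesX x x∉X = trans (sym (g-other x x≢a x≢b)) (fixes m x (remove₂-∉′ x∉X))
        where
          x≢a : ¬ x ≡ a
          x≢a refl = true≢false a∈X x∉X
          x≢b : ¬ x ≡ b
          x≢b refl = true≢false b∈X x∉X
          remove₂-∉′ : X x ≡ false → Y x ≡ false
          remove₂-∉′ e rewrite e = refl
      pairsX : ∀ x → X x ≡ true → PairedAt G X f̂ x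
      pairsX x x∈X with x ≟ a | x ≟ b
      ... | yes refl | _ = record
          { partner∈ = subst (λ z → X z ≡ true) (sym fa) b∈X ; partner≢ = λ e → b≢a (trans (sym fa) e)
          ; involutive = trans (cong f̂ fa) fb ; edge = subst (λ z → G x z ≡ true) (sym fa) ab }
      ... | no _ | yes refl = record
          { partner∈ = subst (λ z → X z ≡ true) (sym fb) a∈X ; partner≢ = λ e → b≢a (trans (sym e) fb)
          ; involutive = trans (cong f̂ fb) fa
          ; edge = subst (λ z → G x z ≡ true) (sym fb) (trans (G-sym x a) ab) }
      ... | no x≢a | no x≢b = record
          { partner∈ = proj₁ gx∈
          ; partner≢ = λ e → partner≢ px (trans gx e)
          ; involutive = trans (cong f̂ (sym gx)) (trans (sym (g-other (ĝ x) (proj₁ (proj₂ gx∈′)) (proj₂ (proj₂ gx∈′))))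
                               (involutive px))
          ; edge = subst (λ z → G x z ≡ true) gx (edge px) }
        where
          px : PairedAt G Y ĝ x
          px = pairs m x (remove₂-∈⁺ X a b x x∈X x≢a x≢b)
          gx : ĝ x ≡ f̂ x
          gx = g-other x x≢a x≢b
          gx∈′ : X (ĝ x) ≡ true × ¬ ĝ x ≡ a × ¬ ĝ x ≡ b
          gx∈′ = remove₂-∈⁻ X a b (ĝ x) (partner∈ px)
          gx∈ : X (f̂ x) ≡ true × ¬ f̂ x ≡ a × ¬ f̂ x ≡ b
          gx∈ = subst (λ z → X z ≡ true × ¬ z ≡ a × ¬ z ≡ b) gx gx∈′

-- For symmetric G, grouping the matching maps of G|_X by the partner b of
-- a ∈ X gives pm(X) = Σ_{b ∈ X, b ≠ a} G(a,b) · pm(X ∖ {a,b}).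
module Expansion {n : ℕ} (G : Adj n) (G-sym : ∀ x y → G x y ≡ G y x) where

  term-at : ∀ (X : VSet n) a b → X a ≡ true → ¬ b ≡ a →
            ∑ᵥ n (λ f → (lookup f a == b) ∧ isPM G X f) ≡ (X b ∧ G a b) ∧ pm G (remove₂ X a b)
  term-at X a b a∈X b≢a = begin
      ∑ᵥ n (λ f → (lookup f a == b) ∧ isPM G X f)
    ≡⟨ ∑ᵥ-cong n split ⟩
      ∑ᵥ n (λ f → (lookup f a == b) ∧ F₁ (f [ a ]≔ a))
    ≡⟨ ∑ᵥ-reassign n a b a F₁ ⟩
      ∑ᵥ n (λ f → (lookup f a == a) ∧ F₁ f)
    ≡⟨ ∑ᵥ-cong n reorder ⟩
      ∑ᵥ n (λ f → (lookup f b == a) ∧ F₂ (f [ b ]≔ b))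
    ≡⟨ ∑ᵥ-reassign n b a b F₂ ⟩
      ∑ᵥ n (λ f → (lookup f b == b) ∧ F₂ f)
    ≡⟨ ∑ᵥ-cong n fixed ⟩
      ∑ᵥ n (λ f → c ∧ H f)
    ≡⟨ ∑ᵥ-∧ n c H ⟩
      c ∧ ∑ᵥ n H
    ≡⟨ cong (c ∧_) (sym (pm≡∑ᵥ G Y)) ⟩
      c ∧ pm G Y
    ∎
    where
      open ≡-Reasoning
      Y : VSet n
      Y = remove₂ X a b
      c : Bool
      c = X b ∧ G a b
      H : Vec (Fin n) n → Bool
      H = isPM G Y
      F₁ F₂ : Vec (Fin n) n → Bool
      F₁ h = (lookup h b == a) ∧ (c ∧ H (h [ b ]≔ b))
      F₂ h = (lookup h a == a) ∧ (c ∧ H h)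

      split : ∀ f → (lookup f a == b) ∧ isPM G X f ≡ (lookup f a == b) ∧ F₁ (f [ a ]≔ a)
      split f = ∧-guarded refl (λ fa → trans (bool-ext (to fa) (from fa))
                                              (cong (λ z → (z == a) ∧ (c ∧ H g)) (sym fb≡)))
        where
          open PrescribedPair G G-sym X a b a∈X b≢a f using (g; restrict; extend)
          fb≡ : lookup (f [ a ]≔ a) b ≡ lookup f b
          fb≡ = lookup∘update′ b≢a f a
          to : (lookup f a == b) ≡ true → isPM G X f ≡ true → (lookup f b == a) ∧ (c ∧ H g) ≡ true
          to fa pmX with restrict (==-≡ fa) (isPM-sound G X f pmX)
          ... | fb , b∈X , ab , mY =
            ∧-true⁺ (trans (cong (_== a) fb) (==-refl a)) (∧-true⁺ (∧-true⁺ b∈X ab) (isPM-complete G Y g mY))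
          from : (lookup f a == b) ≡ true → (lookup f b == a) ∧ (c ∧ H g) ≡ true → isPM G X f ≡ true
          from fa e =
            let (fb , r) = ∧-true⁻ e ; (c′ , hg) = ∧-true⁻ r ; (b∈X , ab) = ∧-true⁻ c′ in
            isPM-complete G X f (extend (==-≡ fa) (==-≡ fb) b∈X ab (isPM-sound G Y g hg))

      reorder : ∀ f → (lookup f a == a) ∧ F₁ f ≡ (lookup f b == a) ∧ F₂ (f [ b ]≔ b)
      reorder f = trans (∧-swap (lookup f a == a) (lookup f b == a) _)
                        (cong (λ z → (lookup f b == a) ∧ ((z == a) ∧ (c ∧ H (f [ b ]≔ b))))
                              (sym (lookup∘update′ (≢-sym b≢a) f b)))

      -- a matching map of Y = X ∖ {a,b} fixes a and b
      fixed : ∀ f → (lookup f b == b) ∧ F₂ f ≡ c ∧ H f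
      fixed f = bool-ext (λ e → proj₂ (∧-true⁻ {lookup f a == a} (proj₂ (∧-true⁻ {lookup f b == b} e)))) from
        where
          from : c ∧ H f ≡ true → (lookup f b == b) ∧ F₂ f ≡ true
          from e = ∧-true⁺ (fixed-at b (inj₂ refl)) (∧-true⁺ (fixed-at a (inj₁ refl)) e)
            where
              fixed-at : ∀ z → z ≡ a ⊎ z ≡ b → (lookup f z == z) ≡ true
              fixed-at z z∈ab = trans (cong (_== z) (fixes (isPM-sound G Y f (proj₂ (∧-true⁻ {c} e)))
                                                            z (remove₂-removes X a b z z∈ab)))
                                      (==-refl z)

  -- no matching map fixes a vertex of X
  term-self : ∀ (X : VSet n) a → X a ≡ true → ∑ᵥ n (λ f → (lookup f a == a) ∧ isPM G X f) ≡ false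
  term-self X a a∈X = ∑ᵥ-vanishes n _ vanish
    where
      vanish : ∀ f → (lookup f a == a) ∧ isPM G X f ≡ false
      vanish f with bool-cases (isPM G X f)
      ... | inj₂ e rewrite e = ∧-zeroʳ (lookup f a == a)
      ... | inj₁ e rewrite e = trans (∧-identityʳ _)
                                     (==-≢ (partner≢ (pairs (isPM-sound G X f e) a a∈X)))

  expand : ∀ (X : VSet n) a → X a ≡ true →
           pm G X ≡ ∑ (λ b → (X b ∧ not (b == a) ∧ G a b) ∧ pm G (remove₂ X a b))
  expand X a a∈X = trans (pm≡∑ᵥ G X) (trans (∑ᵥ-partition n a (isPM G X)) (∑-cong term))
    where
      term : ∀ b → ∑ᵥ n (λ f → (lookup f a == b) ∧ isPM G X f)
                   ≡ (X b ∧ not (b == a) ∧ G a b) ∧ pm G (remove₂ X a b)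
      term b with b ≟ a
      ... | yes refl = trans (term-self X b a∈X) (sym (cong (_∧ pm G (remove₂ X b b)) (∧-zeroʳ (X b))))
      ... | no b≢a   = term-at X a b a∈X b≢a

infix 4 _≐_
_≐_ : ∀ {n} → VSet n → VSet n → Set
A ≐ B = ∀ z → A z ≡ B z

pm-ext : ∀ {n} (G : Adj n) {X X′ : VSet n} → X ≐ X′ → pm G X ≡ pm G X′
pm-ext {n} G {X} {X′} X≐X′ =
  trans (pm≡∑ᵥ G X) (trans (∑ᵥ-cong n same-test) (sym (pm≡∑ᵥ G X′)))
  where
    same-test : ∀ f → isPM G X f ≡ isPM G X′ f
    same-test f = cong (foldr _∧_ true) (map-cong at (allFin n))
      where
        at : ∀ x → matchTest G X f x ≡ matchTest G X′ f x
        at x rewrite X≐X′ x | X≐X′ (lookup f x) = refl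

⊕-swap : ∀ {n} (A B C : VSet n) → (A ⊕ B) ⊕ C ≐ (A ⊕ C) ⊕ B
⊕-swap A B C z = xor-swap (A z) (B z) (C z)
  where
    xor-swap : ∀ p q r → (p xor q) xor r ≡ (p xor r) xor q
    xor-swap = solve-∀ boolRing

⊕-cancel : ∀ {n} (A B : VSet n) → (A ⊕ B) ⊕ B ≐ A
⊕-cancel A B z = trans (xor-assoc (A z) (B z) (B z))
                       (trans (cong (A z xor_) (xor-same (B z))) (xor-identityʳ (A z)))

-- pm of the empty set is 1: only the identity map qualifies
pm-empty : ∀ {n} (G : Adj n) (E : VSet n) → (∀ z → E z ≡ false) → pm G E ≡ true
pm-empty {n} G E empty =
  trans (pm≡∑ᵥ G E) (∑ᵥ-unique n (isPM G E) identity only (isPM-complete G E identity identity-matches))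
  where
    identity : Vec (Fin n) n
    identity = tabulate (λ j → j)
    identity-matches : IsMatchingMap G E (lookup identity)
    identity-matches = record { fixes = λ x _ → lookup∘tabulate (λ j → j) x
                        ; pairs = λ x x∈E → ⊥-elim (true≢false x∈E (empty x)) }
    only : ∀ w → isPM G E w ≡ true → ∀ i → lookup w i ≡ lookup identity i
    only w e i = trans (fixes (isPM-sound G E w e) i (empty i)) (sym (lookup∘tabulate (λ j → j) i))

⊕-masked : ∀ {n} (H : Adj n) (A : VSet n) w → H w w ≡ false → ∀ d → (A ⊕ ⁅ w ⁆) d ∧ H w d ≡ A d ∧ H w d
⊕-masked H A w Hww d with w ≟ d
... | yes refl rewrite Hww = trans (∧-zeroʳ _) (sym (∧-zeroʳ (A w)))
... | no _ = cong (_∧ H w d) (xor-identityʳ (A d))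

⊕-removes : ∀ {n} (A : VSet n) b → A b ≡ true → ∀ d → (A ⊕ ⁅ b ⁆) d ≡ A d ∧ not (b == d)
⊕-removes A b b∈A d with b ≟ d
... | yes refl rewrite b∈A = refl
... | no _ = trans (xor-identityʳ (A d)) (sym (∧-identityʳ (A d)))

module SimpleGraph {n : ℕ} (G : Adj n) (simple : IsSimple G) where
  open IsSimple simple
  open Expansion G symmetric using (expand)

  -- the expansion with X ∖ {a,b} written as X ⊕ {a} ⊕ {b}; the loop-freeness
  -- of G takes care of the term b = a
  expand⊕ : ∀ (X : VSet n) a → X a ≡ true →
            pm G X ≡ ∑ (λ b → (X b ∧ G a b) ∧ pm G ((X ⊕ ⁅ a ⁆) ⊕ ⁅ b ⁆))
  expand⊕ X a a∈X = trans (expand X a a∈X) (∑-cong term)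
    where
      term : ∀ b → (X b ∧ not (b == a) ∧ G a b) ∧ pm G (remove₂ X a b)
                   ≡ (X b ∧ G a b) ∧ pm G ((X ⊕ ⁅ a ⁆) ⊕ ⁅ b ⁆)
      term b with b ≟ a
      ... | yes refl rewrite irreflexive b =
        trans (cong (_∧ pm G (remove₂ X b b)) (∧-zeroʳ (X b)))
              (sym (cong (_∧ pm G ((X ⊕ ⁅ b ⁆) ⊕ ⁅ b ⁆)) (∧-zeroʳ (X b))))
      ... | no b≢a = ∧-guarded refl (λ e → pm-ext G (removed (proj₁ (∧-true⁻ e))))
        where
          removed : X b ≡ true → remove₂ X a b ≐ (X ⊕ ⁅ a ⁆) ⊕ ⁅ b ⁆
          removed b∈X z = begin
              X z ∧ not (z == a) ∧ not (z == b)
            ≡⟨ cong₂ (λ p q → X z ∧ not p ∧ not q) (==-sym z a) (==-sym z b) ⟩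
              X z ∧ not (a == z) ∧ not (b == z)
            ≡⟨ sym (∧-assoc (X z) _ _) ⟩
              (X z ∧ not (a == z)) ∧ not (b == z)
            ≡⟨ cong (_∧ not (b == z)) (sym (⊕-removes X a a∈X z)) ⟩
              (X ⊕ ⁅ a ⁆) z ∧ not (b == z)
            ≡⟨ sym (⊕-removes (X ⊕ ⁅ a ⁆) b b∈X⊕a z) ⟩
              ((X ⊕ ⁅ a ⁆) ⊕ ⁅ b ⁆) z
            ∎
            where
              open ≡-Reasoning
              b∈X⊕a : (X ⊕ ⁅ a ⁆) b ≡ true
              b∈X⊕a = trans (cong (X b xor_) (==-≢ (≢-sym b≢a))) (trans (xor-identityʳ (X b)) b∈X)

  pm-singleton : ∀ (Z : VSet n) w → Z w ≡ true → (∀ z → ¬ z ≡ w → Z z ≡ false) → pm G Z ≡ false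
  pm-singleton Z w w∈Z only-w = trans (expand⊕ Z w w∈Z) (∑-vanishes _ term)
    where
      term : ∀ b → (Z b ∧ G w b) ∧ pm G ((Z ⊕ ⁅ w ⁆) ⊕ ⁅ b ⁆) ≡ false
      term b with b ≟ w
      ... | yes refl rewrite irreflexive b = cong (_∧ pm G ((Z ⊕ ⁅ b ⁆) ⊕ ⁅ b ⁆)) (∧-zeroʳ (Z b))
      ... | no b≢w rewrite only-w b b≢w = refl

  pm-pair : ∀ x y → ¬ x ≡ y → pm G (pair x y) ≡ G x y
  pm-pair x y x≢y =
    trans (expand⊕ (pair x y) x (cong (_∨ (y == x)) (==-refl x)))
          (trans (∑-single _ y off-y) at-y)
    where
      emptied : ∀ z → ((pair x y ⊕ ⁅ x ⁆) ⊕ ⁅ y ⁆) z ≡ false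
      emptied z with x ≟ z | y ≟ z
      ... | yes refl | yes refl = ⊥-elim (x≢y refl)
      ... | yes refl | no _     = refl
      ... | no _     | yes refl = refl
      ... | no _     | no _     = refl
      off-y : ∀ b → ¬ b ≡ y → (pair x y b ∧ G x b) ∧ pm G ((pair x y ⊕ ⁅ x ⁆) ⊕ ⁅ b ⁆) ≡ false
      off-y b b≢y with b ≟ x
      ... | yes refl rewrite irreflexive b = cong (_∧ pm G ((pair b y ⊕ ⁅ b ⁆) ⊕ ⁅ b ⁆)) (∧-zeroʳ (pair b y b))
      ... | no b≢x rewrite ==-≢ (≢-sym b≢x) | ==-≢ (≢-sym b≢y) = refl
      at-y : (pair x y y ∧ G x y) ∧ pm G ((pair x y ⊕ ⁅ x ⁆) ⊕ ⁅ y ⁆) ≡ G x y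
      at-y rewrite pm-empty G _ emptied | ==-refl y | ∨-comm (x == y) true = ∧-identityʳ (G x y)

  ⊕-unmask : ∀ (A : VSet n) w b → ((A ⊕ ⁅ w ⁆) b ∧ G w b) ∧ pm G (((A ⊕ ⁅ w ⁆) ⊕ ⁅ w ⁆) ⊕ ⁅ b ⁆)
                                  ≡ (A b ∧ G w b) ∧ pm G (A ⊕ ⁅ b ⁆)
  ⊕-unmask A w b = cong₂ _∧_ (⊕-masked G A w (irreflexive w) b)
                             (pm-ext G (λ z → cong (_xor (b == z)) (⊕-cancel A ⁅ w ⁆ z)))

  -- For w ∉ Y the terms G(w,b)·pm(Y ∪ {w} ∖ {b}), b ∈ Y, cancel: expanding
  -- each at w gives a double sum symmetric in the two removed neighbours.
  pairs-cancel : ∀ (Y : VSet n) w → Y w ≡ false →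
                 ∑ (λ b → (Y b ∧ G w b) ∧ pm G ((Y ⊕ ⁅ w ⁆) ⊕ ⁅ b ⁆)) ≡ false
  pairs-cancel Y w w∉Y = trans (∑-cong row) (∑∑-symmetric t t-sym t-diag)
    where
      t : Fin n → Fin n → Bool
      t b d = (Y b ∧ G w b) ∧ ((Y d ∧ not (b == d) ∧ G w d) ∧ pm G ((Y ⊕ ⁅ b ⁆) ⊕ ⁅ d ⁆))

      t-sym : ∀ b d → t b d ≡ t d b
      t-sym b d =
        trans (shuffle (Y b) (G w b) (Y d) (not (b == d)) (G w d) (pm G ((Y ⊕ ⁅ b ⁆) ⊕ ⁅ d ⁆)))
              (cong₂ (λ e P → (Y d ∧ G w d) ∧ ((Y b ∧ not e ∧ G w b) ∧ P))
                     (==-sym b d) (pm-ext G (⊕-swap Y ⁅ b ⁆ ⁅ d ⁆)))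
        where
          shuffle : ∀ a g c e h p → (a ∧ g) ∧ ((c ∧ e ∧ h) ∧ p) ≡ (c ∧ h) ∧ ((a ∧ e ∧ g) ∧ p)
          shuffle = solve-∀ boolRing

      t-diag : ∀ b → t b b ≡ false
      t-diag b rewrite ==-refl b = vanish (Y b) (G w b) (Y b) (G w b) _
        where
          vanish : ∀ a g c h p → (a ∧ g) ∧ ((c ∧ false ∧ h) ∧ p) ≡ false
          vanish = solve-∀ boolRing

      row : ∀ b → (Y b ∧ G w b) ∧ pm G ((Y ⊕ ⁅ w ⁆) ⊕ ⁅ b ⁆) ≡ ∑ (t b)
      row b = trans (∧-guarded refl (λ e → expand-row (proj₁ (∧-true⁻ e))))
                    (*-distribˡ-sum (Y b ∧ G w b) (λ d → (Y d ∧ not (b == d) ∧ G w d) ∧ pm G ((Y ⊕ ⁅ b ⁆) ⊕ ⁅ d ⁆)))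
        where
          expand-row : Y b ≡ true →
            pm G ((Y ⊕ ⁅ w ⁆) ⊕ ⁅ b ⁆) ≡ ∑ (λ d → (Y d ∧ not (b == d) ∧ G w d) ∧ pm G ((Y ⊕ ⁅ b ⁆) ⊕ ⁅ d ⁆))
          expand-row b∈Y = trans (expand⊕ ((Y ⊕ ⁅ w ⁆) ⊕ ⁅ b ⁆) w w∈) (∑-cong term)
            where
              b≢w : ¬ b ≡ w
              b≢w refl = true≢false b∈Y w∉Y
              w∈ : ((Y ⊕ ⁅ w ⁆) ⊕ ⁅ b ⁆) w ≡ true
              w∈ rewrite w∉Y | ==-refl w | ==-≢ b≢w = refl
              term : ∀ d → (((Y ⊕ ⁅ w ⁆) ⊕ ⁅ b ⁆) d ∧ G w d) ∧ pm G ((((Y ⊕ ⁅ w ⁆) ⊕ ⁅ b ⁆) ⊕ ⁅ w ⁆) ⊕ ⁅ d ⁆)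
                         ≡ (Y d ∧ not (b == d) ∧ G w d) ∧ pm G ((Y ⊕ ⁅ b ⁆) ⊕ ⁅ d ⁆)
              term d = begin
                  (((Y ⊕ ⁅ w ⁆) ⊕ ⁅ b ⁆) d ∧ G w d) ∧ pm G ((((Y ⊕ ⁅ w ⁆) ⊕ ⁅ b ⁆) ⊕ ⁅ w ⁆) ⊕ ⁅ d ⁆)
                ≡⟨ cong₂ (λ s P → (s ∧ G w d) ∧ P) (⊕-swap Y ⁅ w ⁆ ⁅ b ⁆ d)
                         (pm-ext G (λ z → cong (_xor (d == z)) (⊕-swap (Y ⊕ ⁅ w ⁆) ⁅ b ⁆ ⁅ w ⁆ z))) ⟩
                  (((Y ⊕ ⁅ b ⁆) ⊕ ⁅ w ⁆) d ∧ G w d) ∧ pm G ((((Y ⊕ ⁅ w ⁆) ⊕ ⁅ w ⁆) ⊕ ⁅ b ⁆) ⊕ ⁅ d ⁆)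
                ≡⟨ cong₂ _∧_ (⊕-masked G (Y ⊕ ⁅ b ⁆) w (irreflexive w) d)
                             (pm-ext G (λ z → cong (λ s → (s xor (b == z)) xor (d == z)) (⊕-cancel Y ⁅ w ⁆ z))) ⟩
                  ((Y ⊕ ⁅ b ⁆) d ∧ G w d) ∧ pm G ((Y ⊕ ⁅ b ⁆) ⊕ ⁅ d ⁆)
                ≡⟨ cong (λ s → (s ∧ G w d) ∧ pm G ((Y ⊕ ⁅ b ⁆) ⊕ ⁅ d ⁆)) (⊕-removes Y b b∈Y d) ⟩
                  ((Y d ∧ not (b == d)) ∧ G w d) ∧ pm G ((Y ⊕ ⁅ b ⁆) ⊕ ⁅ d ⁆)
                ≡⟨ cong (_∧ pm G ((Y ⊕ ⁅ b ⁆) ⊕ ⁅ d ⁆)) (∧-assoc (Y d) _ _) ⟩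
                  (Y d ∧ not (b == d) ∧ G w d) ∧ pm G ((Y ⊕ ⁅ b ⁆) ⊕ ⁅ d ⁆)
                ∎
                where open ≡-Reasoning

  neighbour-sum : ∀ (Z : VSet n) w →
                  ∑ (λ b → (Z b ∧ G w b) ∧ pm G (Z ⊕ ⁅ b ⁆)) ≡ not (Z w) ∧ pm G (Z ⊕ ⁅ w ⁆)
  neighbour-sum Z w with bool-cases (Z w)
  ... | inj₁ w∈Z rewrite w∈Z =
    trans (∑-cong (λ b → sym (⊕-unmask Z w b))) (pairs-cancel (Z ⊕ ⁅ w ⁆) w w∉Z⊕w)
    where
      w∉Z⊕w : (Z ⊕ ⁅ w ⁆) w ≡ false
      w∉Z⊕w rewrite w∈Z | ==-refl w = refl
  ... | inj₂ w∉Z rewrite w∉Z =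
    sym (trans (expand⊕ (Z ⊕ ⁅ w ⁆) w w∈Z⊕w) (∑-cong (⊕-unmask Z w)))
    where
      w∈Z⊕w : (Z ⊕ ⁅ w ⁆) w ≡ true
      w∈Z⊕w rewrite w∉Z | ==-refl w = refl

  -- For an edge pq:  Σ_b [b ∈ Z ⊕ {p,q}]·[b ∈ N'(q)]·pm(Z ⊕ {b}) = pm(Z ⊕ {p}).
  -- The weight splits into the neighbourhood of q (neighbour-sum) and
  -- indicator terms at q and p.
  closed-neighbour-sum : ∀ p q → G p q ≡ true → ∀ (Z : VSet n) →
      ∑ (λ b → ((Z ⊕ pair p q) b ∧ N' G q b) ∧ pm G (Z ⊕ ⁅ b ⁆)) ≡ pm G (Z ⊕ ⁅ p ⁆)
  closed-neighbour-sum p q pq Z = begin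
      ∑ (λ b → ((Z ⊕ pair p q) b ∧ N' G q b) ∧ Q b)
    ≡⟨ ∑-cong (λ b → trans (cong (_∧ Q b) (weight b (b ≟ q) (b ≟ p)))
                           (distrib (Z b ∧ G q b) (q == b) (not (Z b)) (p == b) (Q b))) ⟩
      ∑ (λ b → ((Z b ∧ G q b) ∧ Q b) xor (((q == b) ∧ (not (Z b) ∧ Q b)) xor ((p == b) ∧ Q b)))
    ≡⟨ ∑-distrib-+ (λ b → (Z b ∧ G q b) ∧ Q b) _ ⟩
      ∑ (λ b → (Z b ∧ G q b) ∧ Q b) xor ∑ (λ b → ((q == b) ∧ (not (Z b) ∧ Q b)) xor ((p == b) ∧ Q b))
    ≡⟨ cong₂ _xor_ (neighbour-sum Z q) (∑-distrib-+ (λ b → (q == b) ∧ (not (Z b) ∧ Q b)) (λ b → (p == b) ∧ Q b)) ⟩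
      (not (Z q) ∧ Q q) xor (∑ (λ b → (q == b) ∧ (not (Z b) ∧ Q b)) xor ∑ (λ b → (p == b) ∧ Q b))
    ≡⟨ cong₂ (λ s t → (not (Z q) ∧ Q q) xor (s xor t)) (∑-δ q (λ b → not (Z b) ∧ Q b)) (∑-δ p Q) ⟩
      (not (Z q) ∧ Q q) xor ((not (Z q) ∧ Q q) xor Q p)
    ≡⟨ xor-cancelˡ (not (Z q) ∧ Q q) (Q p) ⟩
      Q p
    ∎
    where
      open ≡-Reasoning
      Q : Fin n → Bool
      Q b = pm G (Z ⊕ ⁅ b ⁆)

      distrib : ∀ x y₁ y₂ z w → (x xor ((y₁ ∧ y₂) xor z)) ∧ w ≡ (x ∧ w) xor ((y₁ ∧ (y₂ ∧ w)) xor (z ∧ w))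
      distrib = solve-∀ boolRing

      p≢q : ¬ p ≡ q
      p≢q refl = true≢false pq (irreflexive p)

      weight : ∀ b → Dec (b ≡ q) → Dec (b ≡ p) →
               (Z ⊕ pair p q) b ∧ N' G q b ≡ (Z b ∧ G q b) xor (((q == b) ∧ not (Z b)) xor (p == b))
      weight b (yes refl) _ rewrite ==-refl b | irreflexive b | ==-≢ p≢q with Z b
      ... | true  = refl
      ... | false = refl
      weight b (no b≢q) (yes refl) rewrite ==-refl b | ==-≢ (≢-sym b≢q) | trans (symmetric q b) pq with Z b
      ... | true  = refl
      ... | false = refl
      weight b (no b≢q) (no b≢p) rewrite ==-≢ (≢-sym b≢q) | ==-≢ (≢-sym b≢p) with Z b | G q b
      ... | true  | true  = refl
      ... | true  | false = refl
      ... | false | true  = refl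
      ... | false | false = refl

classFrom : Bool → Bool → Class
classFrom true  false = c1
classFrom false true  = c2
classFrom true  true  = c3
classFrom false false = none

classOf≡classFrom : ∀ {n} (G : Adj n) u v z → classOf G u v z ≡ classFrom (N' G u z) (N' G v z)
classOf≡classFrom G u v z with N' G u z | N' G v z
... | true  | false = refl
... | false | true  = refl
... | true  | true  = refl
... | false | false = refl

differentV-bilinear : ∀ a b c d → differentV (classFrom a b) (classFrom c d) ≡ (a ∧ d) xor (b ∧ c)
differentV-bilinear false false c     d     = refl
differentV-bilinear false true  false false = refl
differentV-bilinear false true  false true  = refl
differentV-bilinear false true  true  false = refl
differentV-bilinear false true  true  true  = refl
differentV-bilinear true  false false false = refl
differentV-bilinear true  false false true  = refl
differentV-bilinear true  false true  false = refl
differentV-bilinear true  false true  true  = refl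
differentV-bilinear true  true  false false = refl
differentV-bilinear true  true  false true  = refl
differentV-bilinear true  true  true  false = refl
differentV-bilinear true  true  true  true  = refl

pivot-bilinear : ∀ {n} (G : Adj n) u v x y →
  pivot G u v x y ≡ G x y xor ((N' G u x ∧ N' G v y) xor (N' G v x ∧ N' G u y))
pivot-bilinear G u v x y rewrite classOf≡classFrom G u v x | classOf≡classFrom G u v y =
  cong (G x y xor_) (differentV-bilinear (N' G u x) (N' G v x) (N' G u y) (N' G v y))

-- the toggled form is symmetric with vanishing diagonal, so pivots
-- preserve simple graphs
pivot-simple : ∀ {n} {G : Adj n} → IsSimple G → ∀ u v → IsSimple (pivot G u v)
pivot-simple {G = G} simple u v = record
  { symmetric = λ x y → begin
      pivot G u v x y
    ≡⟨ pivot-bilinear G u v x y ⟩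
      G x y xor ((α x ∧ β y) xor (β x ∧ α y))
    ≡⟨ cong₂ _xor_ (symmetric x y) (form-sym (α x) (β y) (β x) (α y)) ⟩
      G y x xor ((α y ∧ β x) xor (β y ∧ α x))
    ≡⟨ sym (pivot-bilinear G u v y x) ⟩
      pivot G u v y x
    ∎
  ; irreflexive = λ x → begin
      pivot G u v x x
    ≡⟨ pivot-bilinear G u v x x ⟩
      G x x xor ((α x ∧ β x) xor (β x ∧ α x))
    ≡⟨ cong₂ (λ g t → g xor ((α x ∧ β x) xor t)) (irreflexive x) (∧-comm (β x) (α x)) ⟩
      false xor ((α x ∧ β x) xor (α x ∧ β x))
    ≡⟨ xor-same (α x ∧ β x) ⟩
      false
    ∎
  }
  where
    open ≡-Reasoning
    open IsSimple simple
    α β : Fin _ → Bool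
    α = N' G u
    β = N' G v
    form-sym : ∀ a b c d → (a ∧ b) xor (c ∧ d) ≡ (d ∧ c) xor (b ∧ a)
    form-sym = solve-∀ boolRing

pivot-keeps-edge : ∀ {n} {G : Adj n} → IsSimple G → ∀ u v → G u v ≡ true → pivot G u v u v ≡ true
pivot-keeps-edge {G = G} simple u v uv
  rewrite pivot-bilinear G u v u v | ==-refl u | ==-refl v | uv | IsSimple.symmetric simple v u | uv
        | ∨-zeroʳ (G u u) | ∨-zeroʳ (G v v) = refl

-- Induction on the part of X outside {u,v}: a vertex set X is "within"
-- a list L if X ⊆ L ∪ {u,v}.

module PivotLemma {n : ℕ} (G : Adj n) (simple : IsSimple G) (u v : Fin n) (uv : G u v ≡ true) where
  open IsSimple simple

  G′ : Adj n
  G′ = pivot G u v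

  module S  = SimpleGraph G simple
  module S′ = SimpleGraph G′ (pivot-simple simple u v)

  UV : VSet n
  UV = pair u v

  α β : Fin n → Bool
  α = N' G u
  β = N' G v

  u≢v : ¬ u ≡ v
  u≢v refl = true≢false uv (irreflexive u)

  UV-u : UV u ≡ true
  UV-u rewrite ==-refl u = refl

  UV-v : UV v ≡ true
  UV-v rewrite ==-refl v = ∨-zeroʳ (u == v)

  UV-outside : ∀ z → ¬ z ≡ u → ¬ z ≡ v → UV z ≡ false
  UV-outside z z≢u z≢v rewrite ==-≢ (≢-sym z≢u) | ==-≢ (≢-sym z≢v) = refl

  Pivots : VSet n → Set
  Pivots X = pm G′ X ≡ pm G (X ⊕ UV)

  Within : List (Fin n) → VSet n → Set
  Within L X = ∀ z → X z ≡ true → z ∈ L ⊎ z ≡ u ⊎ z ≡ v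

  -- X ⊆ {u,v}: X is one of ∅, {u}, {v}, {u,v}
  base : ∀ X → Within [] X → Pivots X
  base X within = cases (bool-cases (X u)) (bool-cases (X v))
    where
      outside : ∀ z → ¬ z ≡ u → ¬ z ≡ v → X z ≡ false
      outside z z≢u z≢v with bool-cases (X z)
      ... | inj₂ z∉X = z∉X
      ... | inj₁ z∈X with within z z∈X
      ...   | inj₂ (inj₁ z≡u) = ⊥-elim (z≢u z≡u)
      ...   | inj₂ (inj₂ z≡v) = ⊥-elim (z≢v z≡v)

      cases : X u ≡ true ⊎ X u ≡ false → X v ≡ true ⊎ X v ≡ false → Pivots X
      cases (inj₂ u∉X) (inj₂ v∉X) =
        trans (pm-empty G′ X empty)
              (sym (trans (pm-ext G (λ z → cong (_xor UV z) (empty z))) (trans (S.pm-pair u v u≢v) uv)))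
        where
          empty : ∀ z → X z ≡ false
          empty z with z ≟ u | z ≟ v
          ... | yes refl | _        = u∉X
          ... | no _     | yes refl = v∉X
          ... | no z≢u   | no z≢v   = outside z z≢u z≢v
      cases (inj₁ u∈X) (inj₁ v∈X) =
        trans (pm-ext G′ X≐UV)
              (trans (S′.pm-pair u v u≢v)
                     (trans (pivot-keeps-edge simple u v uv)
                            (sym (pm-empty G (X ⊕ UV) (λ z → trans (cong (_xor UV z) (X≐UV z)) (xor-same (UV z)))))))
        where
          X≐UV : X ≐ UV
          X≐UV z with z ≟ u | z ≟ v
          ... | yes refl | _        = trans u∈X (sym UV-u)
          ... | no _     | yes refl = trans v∈X (sym UV-v)
          ... | no z≢u   | no z≢v   = trans (outside z z≢u z≢v) (sym (UV-outside z z≢u z≢v))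
      cases (inj₁ u∈X) (inj₂ v∉X) =
        trans (S′.pm-singleton X u u∈X only-u)
              (sym (S.pm-singleton (X ⊕ UV) v (trans (cong (_xor UV v) v∉X) UV-v) only-v))
        where
          only-u : ∀ z → ¬ z ≡ u → X z ≡ false
          only-u z z≢u with z ≟ v
          ... | yes refl = v∉X
          ... | no z≢v   = outside z z≢u z≢v
          only-v : ∀ z → ¬ z ≡ v → (X ⊕ UV) z ≡ false
          only-v z z≢v with z ≟ u
          ... | yes refl = cong₂ _xor_ u∈X UV-u
          ... | no z≢u   = cong₂ _xor_ (outside z z≢u z≢v) (UV-outside z z≢u z≢v)
      cases (inj₂ u∉X) (inj₁ v∈X) =
        trans (S′.pm-singleton X v v∈X only-v)
              (sym (S.pm-singleton (X ⊕ UV) u (trans (cong (_xor UV u) u∉X) UV-u) only-u))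
        where
          only-v : ∀ z → ¬ z ≡ v → X z ≡ false
          only-v z z≢v with z ≟ u
          ... | yes refl = u∉X
          ... | no z≢u   = outside z z≢u z≢v
          only-u : ∀ z → ¬ z ≡ u → (X ⊕ UV) z ≡ false
          only-u z z≢u with z ≟ v
          ... | yes refl = cong₂ _xor_ v∈X UV-v
          ... | no z≢v   = cong₂ _xor_ (outside z z≢u z≢v) (UV-outside z z≢u z≢v)

  P : VSet n → Fin n → Bool
  P Z b = pm G (Z ⊕ ⁅ b ⁆)

  -- The correction coming from the bilinear toggle vanishes: by
  -- closed-neighbour-sum its two parts give α(c)·P(u) + β(c)·P(v), which
  -- equals the contribution G(c,u)·P(u) + G(c,v)·P(v) of the terms b ∈ {u,v}.
  correction-vanishes : ∀ c (Z : VSet n) → ¬ c ≡ u → ¬ c ≡ v →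
    ∑ (λ b → ((UV b ∧ G c b) ∧ P Z b)
             xor ((α c ∧ (((Z ⊕ UV) b ∧ β b) ∧ P Z b)) xor (β c ∧ (((Z ⊕ UV) b ∧ α b) ∧ P Z b))))
    ≡ false
  correction-vanishes c Z c≢u c≢v = begin
      ∑ (λ b → ((UV b ∧ G c b) ∧ Q b) xor (A b xor B b))
    ≡⟨ ∑-distrib-+ (λ b → (UV b ∧ G c b) ∧ Q b) (λ b → A b xor B b) ⟩
      ∑ (λ b → (UV b ∧ G c b) ∧ Q b) xor ∑ (λ b → A b xor B b)
    ≡⟨ cong₂ _xor_ at-uv (∑-distrib-+ A B) ⟩
      ((G c u ∧ Q u) xor (G c v ∧ Q v)) xor (∑ A xor ∑ B)
    ≡⟨ cong (λ s → ((G c u ∧ Q u) xor (G c v ∧ Q v)) xor s)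
            (cong₂ _xor_ (trans (sym (*-distribˡ-sum (α c) (λ b → ((Z ⊕ UV) b ∧ β b) ∧ Q b)))
                                (cong₂ _∧_ αc (S.closed-neighbour-sum u v uv Z)))
                         (trans (sym (*-distribˡ-sum (β c) (λ b → ((Z ⊕ UV) b ∧ α b) ∧ Q b)))
                                (cong₂ _∧_ βc (trans (∑-cong (λ b → cong (λ s → ((Z b xor s) ∧ α b) ∧ Q b)
                                                                         (∨-comm (u == b) (v == b))))
                                                     (S.closed-neighbour-sum v u vu Z))))) ⟩
      ((G c u ∧ Q u) xor (G c v ∧ Q v)) xor ((G c u ∧ Q u) xor (G c v ∧ Q v))
    ≡⟨ xor-same ((G c u ∧ Q u) xor (G c v ∧ Q v)) ⟩
      false
    ∎
    where
      open ≡-Reasoning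
      Q : Fin n → Bool
      Q = P Z
      A B : Fin n → Bool
      A b = α c ∧ (((Z ⊕ UV) b ∧ β b) ∧ Q b)
      B b = β c ∧ (((Z ⊕ UV) b ∧ α b) ∧ Q b)
      vu : G v u ≡ true
      vu = trans (symmetric v u) uv
      αc : α c ≡ G c u
      αc rewrite ==-≢ (≢-sym c≢u) = trans (∨-identityʳ (G u c)) (symmetric u c)
      βc : β c ≡ G c v
      βc rewrite ==-≢ (≢-sym c≢v) = trans (∨-identityʳ (G v c)) (symmetric v c)
      at-uv : ∑ (λ b → (UV b ∧ G c b) ∧ Q b) ≡ (G c u ∧ Q u) xor (G c v ∧ Q v)
      at-uv = begin
          ∑ (λ b → (UV b ∧ G c b) ∧ Q b)
        ≡⟨ ∑-cong (λ b → trans (cong (λ s → (s ∧ G c b) ∧ Q b) (pair≡⊕ u≢v b))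
                               (split (u == b) (v == b) (G c b) (Q b))) ⟩
          ∑ (λ b → ((u == b) ∧ (G c b ∧ Q b)) xor ((v == b) ∧ (G c b ∧ Q b)))
        ≡⟨ ∑-distrib-+ (λ b → (u == b) ∧ (G c b ∧ Q b)) (λ b → (v == b) ∧ (G c b ∧ Q b)) ⟩
          ∑ (λ b → (u == b) ∧ (G c b ∧ Q b)) xor ∑ (λ b → (v == b) ∧ (G c b ∧ Q b))
        ≡⟨ cong₂ _xor_ (∑-δ u (λ b → G c b ∧ Q b)) (∑-δ v (λ b → G c b ∧ Q b)) ⟩
          (G c u ∧ Q u) xor (G c v ∧ Q v)
        ∎
        where
          split : ∀ x y g q → ((x xor y) ∧ g) ∧ q ≡ (x ∧ (g ∧ q)) xor (y ∧ (g ∧ q))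
          split = solve-∀ boolRing

  ⊕-removed : ∀ (A : VSet n) b → A b ≡ true → ∀ z → (A ⊕ ⁅ b ⁆) z ≡ true → A z ≡ true × ¬ b ≡ z
  ⊕-removed A b b∈A z e =
    let (z∈A , b≢z) = ∧-true⁻ (trans (sym (⊕-removes A b b∈A z)) e) in
    z∈A , ==-false⇒≢ (not-true⁻ b≢z)

  -- The inductive step: expand both sides at a vertex c ∈ X ∖ {u,v}.  With
  -- Z = X ⊕ {c} ⊕ {u,v}, both expansions are sums of P Z b, and they
  -- differ by the vanishing correction.
  expand-both : ∀ X c → X c ≡ true → ¬ c ≡ u → ¬ c ≡ v →
                (∀ b → X b ∧ G′ c b ≡ true → Pivots ((X ⊕ ⁅ c ⁆) ⊕ ⁅ b ⁆)) → Pivots X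
  expand-both X c c∈X c≢u c≢v IH = trans lhs (sym rhs)
    where
      open ≡-Reasoning
      Z : VSet n
      Z = (X ⊕ ⁅ c ⁆) ⊕ UV
      Q : Fin n → Bool
      Q = P Z
      R : Bool
      R = ∑ (λ b → (Z b ∧ G c b) ∧ Q b)

      X⊕UV≐Z⊕c : X ⊕ UV ≐ Z ⊕ ⁅ c ⁆
      X⊕UV≐Z⊕c z = sym (trans (⊕-swap (X ⊕ ⁅ c ⁆) UV ⁅ c ⁆ z) (cong (_xor UV z) (⊕-cancel X ⁅ c ⁆ z)))

      rhs : pm G (X ⊕ UV) ≡ R
      rhs = trans (pm-ext G X⊕UV≐Z⊕c)
                  (trans (S.expand⊕ (Z ⊕ ⁅ c ⁆) c c∈Z⊕c) (∑-cong (S.⊕-unmask Z c)))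
        where
          c∈Z⊕c : (Z ⊕ ⁅ c ⁆) c ≡ true
          c∈Z⊕c = trans (sym (X⊕UV≐Z⊕c c)) (trans (cong (X c xor_) (UV-outside c c≢u c≢v))
                                                  (trans (xor-identityʳ (X c)) c∈X))

      expand-form : ∀ z w g x y s t q →
        ((z xor w) ∧ (g xor ((x ∧ y) xor (s ∧ t)))) ∧ q
          ≡ ((z ∧ g) ∧ q) xor (((w ∧ g) ∧ q) xor ((x ∧ (((z xor w) ∧ y) ∧ q)) xor (s ∧ (((z xor w) ∧ t) ∧ q))))
      expand-form = solve-∀ boolRing

      lhs : pm G′ X ≡ R
      lhs = begin
          pm G′ X
        ≡⟨ S′.expand⊕ X c c∈X ⟩
          ∑ (λ b → (X b ∧ G′ c b) ∧ pm G′ ((X ⊕ ⁅ c ⁆) ⊕ ⁅ b ⁆))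
        ≡⟨ ∑-cong (λ b → ∧-guarded refl (λ e → trans (IH b e) (pm-ext G (⊕-swap (X ⊕ ⁅ c ⁆) ⁅ b ⁆ UV)))) ⟩
          ∑ (λ b → (X b ∧ G′ c b) ∧ Q b)
        ≡⟨ ∑-cong (λ b → cong (_∧ Q b) (trans (cong (_∧ G′ c b) (X≐ b))
                                              (⊕-masked G′ (Z ⊕ UV) c (IsSimple.irreflexive (pivot-simple simple u v) c) b))) ⟩
          ∑ (λ b → ((Z ⊕ UV) b ∧ G′ c b) ∧ Q b)
        ≡⟨ ∑-cong (λ b → trans (cong (λ g → ((Z ⊕ UV) b ∧ g) ∧ Q b) (pivot-bilinear G u v c b))
                               (expand-form (Z b) (UV b) (G c b) (α c) (β b) (β c) (α b) (Q b))) ⟩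
          ∑ (λ b → ((Z b ∧ G c b) ∧ Q b)
                   xor (((UV b ∧ G c b) ∧ Q b)
                        xor ((α c ∧ (((Z ⊕ UV) b ∧ β b) ∧ Q b)) xor (β c ∧ (((Z ⊕ UV) b ∧ α b) ∧ Q b)))))
        ≡⟨ ∑-distrib-+ (λ b → (Z b ∧ G c b) ∧ Q b) _ ⟩
          R xor ∑ (λ b → ((UV b ∧ G c b) ∧ Q b)
                         xor ((α c ∧ (((Z ⊕ UV) b ∧ β b) ∧ Q b)) xor (β c ∧ (((Z ⊕ UV) b ∧ α b) ∧ Q b))))
        ≡⟨ cong (R xor_) (correction-vanishes c Z c≢u c≢v) ⟩
          R xor false
        ≡⟨ xor-identityʳ R ⟩
          R
        ∎
        where
          X≐ : X ≐ (Z ⊕ UV) ⊕ ⁅ c ⁆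
          X≐ z = sym (trans (cong (_xor (c == z)) (⊕-cancel (X ⊕ ⁅ c ⁆) UV z)) (⊕-cancel X ⁅ c ⁆ z))

  drop-head : ∀ c L X → Within (c ∷ L) X → X c ≡ false ⊎ c ≡ u ⊎ c ≡ v → Within L X
  drop-head c L X within c-irrelevant z z∈X with within z z∈X
  ... | inj₂ z∈uv        = inj₂ z∈uv
  ... | inj₁ (there z∈L) = inj₁ z∈L
  ... | inj₁ (here refl) with c-irrelevant
  ...   | inj₁ c∉X  = ⊥-elim (true≢false z∈X c∉X)
  ...   | inj₂ c∈uv = inj₂ c∈uv

  pivots-within : ∀ L X → Within L X → Pivots X
  pivots-within []      X within = base X within
  pivots-within (c ∷ L) X within = at-c (bool-cases (X c)) (c ≟ u) (c ≟ v)
    where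
      at-c : X c ≡ true ⊎ X c ≡ false → Dec (c ≡ u) → Dec (c ≡ v) → Pivots X
      at-c (inj₂ c∉X) _ _ = pivots-within L X (drop-head c L X within (inj₁ c∉X))
      at-c _ (yes c≡u) _  = pivots-within L X (drop-head c L X within (inj₂ (inj₁ c≡u)))
      at-c _ _ (yes c≡v)  = pivots-within L X (drop-head c L X within (inj₂ (inj₂ c≡v)))
      at-c (inj₁ c∈X) (no c≢u) (no c≢v) = expand-both X c c∈X c≢u c≢v IH
        where
          IH : ∀ b → X b ∧ G′ c b ≡ true → Pivots ((X ⊕ ⁅ c ⁆) ⊕ ⁅ b ⁆)
          IH b e = pivots-within L _ within′
            where
              b∈X : X b ≡ true
              b∈X = proj₁ (∧-true⁻ e)
              c≢b : ¬ c ≡ b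
              c≢b refl = true≢false (proj₂ (∧-true⁻ e)) (IsSimple.irreflexive (pivot-simple simple u v) c)
              b∈X⊕c : (X ⊕ ⁅ c ⁆) b ≡ true
              b∈X⊕c = trans (cong (X b xor_) (==-≢ c≢b)) (trans (xor-identityʳ (X b)) b∈X)
              within′ : Within L ((X ⊕ ⁅ c ⁆) ⊕ ⁅ b ⁆)
              within′ z z∈ with ⊕-removed (X ⊕ ⁅ c ⁆) b b∈X⊕c z z∈
              ... | z∈X⊕c , _ with ⊕-removed X c c∈X z z∈X⊕c
              ...   | z∈X , c≢z with within z z∈X
              ...     | inj₁ (here z≡c)  = ⊥-elim (c≢z (sym z≡c))
              ...     | inj₁ (there z∈L) = inj₁ z∈L
              ...     | inj₂ z∈uv        = inj₂ z∈uv

  pivot-lemma : ∀ X → pm (pivot G u v) X ≡ pm G (X ⊕ pair u v)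
  pivot-lemma X = pivots-within (allFin n) X (λ z _ → inj₁ (∈-allFin z))

pivot-sequence : ∀ {n} (G : Adj n) → IsSimple G → (φ : PivotSeq n) → Applicable G φ →
                 IsSimple (applySeq G φ) × (∀ Z → pm (applySeq G φ) Z ≡ pm G (Z ⊕ sup φ))
pivot-sequence G simple [] _ = simple , λ Z → pm-ext G (λ z → sym (xor-identityʳ (Z z)))
pivot-sequence G simple ((u , v) ∷ φ) (uv , applicable)
  with pivot-sequence (pivot G u v) (pivot-simple simple u v) φ applicable
... | simple-φ , pm-φ = simple-φ , λ Z →
  trans (pm-φ Z) (trans (PivotLemma.pivot-lemma G simple u v uv (Z ⊕ sup φ)) (pm-ext G (regroup Z)))
  where
    u≢v : ¬ u ≡ v
    u≢v refl = true≢false uv (IsSimple.irreflexive simple u)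
    regroup : ∀ Z → (Z ⊕ sup φ) ⊕ pair u v ≐ Z ⊕ sup ((u , v) ∷ φ)
    regroup Z z = trans (cong ((Z z xor sup φ z) xor_) (pair≡⊕ u≢v z)) (reassoc (Z z) (sup φ z) _)
      where
        reassoc : ∀ a s p → (a xor s) xor p ≡ a xor (p xor s)
        reassoc = solve-∀ boolRing

theorem4 : (n : ℕ) (G : Adj n) → IsSimple G → (φ : PivotSeq n) → Applicable G φ →
           (x y : Fin n) → ¬ (x ≡ y) →
           (applySeq G φ x y ≡ true) ⇔ (pm G (sup φ ⊕ pair x y) ≡ true)
theorem4 n G simple φ applicable x y x≢y = mk⇔ (trans (sym adjacency≡pm)) (trans adjacency≡pm)
  where
    open ≡-Reasoning
    Gφ : Adj n
    Gφ = applySeq G φ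
    adjacency≡pm : Gφ x y ≡ pm G (sup φ ⊕ pair x y)
    adjacency≡pm with pivot-sequence G simple φ applicable
    ... | simple-φ , pm-φ = begin
        Gφ x y
      ≡⟨ sym (SimpleGraph.pm-pair Gφ simple-φ x y x≢y) ⟩
        pm Gφ (pair x y)
      ≡⟨ pm-φ (pair x y) ⟩
        pm G (pair x y ⊕ sup φ)
      ≡⟨ pm-ext G (λ z → xor-comm (pair x y z) (sup φ z)) ⟩
        pm G (sup φ ⊕ pair x y)
      ∎
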